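{- For all $n\ge1$ and all interpretation variables $k$: $${\sf FIL}\vdash\mathsf U_n\wedge(D_n\rhd A)\wedge(A\rhd^k B)\rhd^k B\wedge\Box C,$$ where for arbitrary ${\sf FIL}$-formulas $A,B,C,D_1,D_2,\dots$: $\mathsf U_1:=\Diamond\neg(D_1\rhd\neg C)$ and $\mathsf U_{m+1}:=\Diamond((D_m\rhd D_{m+1})\wedge\mathsf U_m)$ for $m\ge1$.
   Context: The logic ${\sf FIL}$: the language has propositional variables, interpretation variables $k_0,k_1,\dots$, one interpretation constant ${\sf id}$, $\top,\bot$, Boolean connectives and modalities $\Box^{\mathfrak a}A$, $A\rhd^{\mathfrak a}B$ where $\mathfrak a$ is a finite sequence of interpretation terms without repetition; unlabelled $\Box,\rhd$ stand for label ${\sf id}$ / the empty sequence; $\Diamond^{\mathfrak a}:=\neg\Box^{\mathfrak a}\neg$; $\mathfrak a,k$ is $\mathfrak a$ extended by $k$. Sequents $\Gamma\vdash C$ with $\Gamma$ a multiset, with $\Gamma,\Delta\vdash C$ iff $\Delta\vdash\bigwedge\Gamma\to C$. Axioms/rules (for all labels $\mathfrak a,\mathfrak b$, terms $k$): all tautologies; modus ponens; $\Box^{\mathfrak a}(A\to B)\to(\Box^{\mathfrak a}A\to\Box^{\mathfrak a}B)$; $\Box^{\mathfrak b}A\to\Box^{\mathfrak a}\Box^{\mathfrak b}A$; $\Box^{\mathfrak a}(\Box^{\mathfrak a}A\to A)\to\Box^{\mathfrak a}A$; $\Box^{\mathfrak a}(A\to B)\to A\rhd^{\mathfrak a}B$;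 $(A\rhd B)\wedge(B\rhd^{\mathfrak a}C)\to A\rhd^{\mathfrak a}C$; $(A\rhd^{\mathfrak a}B)\wedge\Box^{\mathfrak a}(B\to C)\to A\rhd^{\mathfrak a}C$; $(A\rhd^{\mathfrak a}C)\wedge(B\rhd^{\mathfrak a}C)\to A\vee B\rhd^{\mathfrak a}C$; $A\rhd^{\mathfrak a}B\to(\Diamond A\to\Diamond^{\mathfrak a}B)$; $A\rhd^{\mathfrak a}\Diamond^{\mathfrak b}B\to A\rhd^{\mathfrak b}B$; $\Box^{\mathfrak a,k}A\to\Box^{\mathfrak a}A$; $A\rhd^{\mathfrak a}B\to A\rhd^{\mathfrak a,k}B$; necessitation $\vdash A\Rightarrow\vdash\Box^{\mathfrak a}A$; rule $\mathsf P^{\mathfrak a,\mathfrak b,k}$: from $\Gamma,\Delta,\Box^{\mathfrak b}(A\rhd^{\mathfrak a,k}B)\vdash C$ infer $\Gamma,A\rhd^{\mathfrak a}B\vdash C$, provided $k$ is an interpretation variable not occurring in $\mathfrak a,\Gamma,A,B,C$ and $\Delta$ consists of formulas of the forms $E\rhd^{\mathfrak a,k}F\to E\rhd^{\mathfrak a}F$ and $\Box^{\mathfrak a}E\to\Box^{\mathfrak a,k}E$. Binding: $\neg,\Box,\Diamond$ strongest, Boolean connectives other than $\to$ (in particular $\wedge$) bind stronger than $\rhd$, $\rhd$ stronger than $\to$. -}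

module Defs where

open import Data.Nat using (ℕ; zero; suc)
open import Data.Bool using (Bool; true; false; not; _∧_; _∨_)
open import Data.List using (List; []; _∷_; _++_)
open import Data.List.Membership.Propositional using (_∈_; _∉_)
open import Data.List.Relation.Unary.All using (All)
open import Data.List.Relation.Unary.All.Properties using (¬Any⇒All¬)
open import Data.List.Relation.Unary.AllPairs using (AllPairs; _∷_)
open import Data.List.Relation.Unary.Unique.Propositional using (Unique)
open import Data.Product using (Σ; _×_; _,_)
open import Data.Sum using (_⊎_)
open import Relation.Binary.PropositionalEquality using (_≡_)
open import Relation.Nullary using (¬_)

data Term : Set where
  ivar : ℕ → Term
  idt  : Term

-- Labels: finite sequences of terms without repetition.
-- The list is stored in REVERSED order (last element first), so that
-- the extension 𝔞,k is  k ∷ seq 𝔞.  Order is otherwise immaterial.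

record Label : Set where
  constructor mkLabel
  field
    seq     : List Term
    .unique : Unique seq
open Label public

ε : Label
ε = mkLabel [] AllPairs.[]

ext : (𝔞 : Label) (k : Term) → k ∉ seq 𝔞 → Label
ext (mkLabel xs u) k k∉ = mkLabel (k ∷ xs) (¬Any⇒All¬ xs k∉ ∷ u)

single : Term → Label
single k = mkLabel (k ∷ []) (All.[] ∷ AllPairs.[])

infixr 4 _⇒_
infixr 5 _∨'_
infixr 6 _∧'_
infix 4.5 _▷⟨_⟩_ _▷_
infix 9 ¬'_ □⟨_⟩_ ◇⟨_⟩_ □_ ◇_

data Formula : Set where
  pvar  : ℕ → Formula
  ⊤'    : Formula
  ⊥'    : Formula
  ¬'_   : Formula → Formula
  _∧'_  : Formula → Formula → Formula
  _∨'_  : Formula → Formula → Formula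
  _⇒_   : Formula → Formula → Formula
  □⟨_⟩_ : Label → Formula → Formula
  _▷⟨_⟩_ : Formula → Label → Formula → Formula

◇⟨_⟩_ : Label → Formula → Formula
◇⟨ 𝔞 ⟩ A = ¬' (□⟨ 𝔞 ⟩ (¬' A))

□_ : Formula → Formula
□ A = □⟨ ε ⟩ A

◇_ : Formula → Formula
◇ A = ◇⟨ ε ⟩ A

_▷_ : Formula → Formula → Formula
A ▷ B = A ▷⟨ ε ⟩ B

eval : (Formula → Bool) → Formula → Bool
eval v (pvar p)      = v (pvar p)
eval v ⊤'            = true
eval v ⊥'            = false
eval v (¬' A)        = not (eval v A)
eval v (A ∧' B)      = eval v A ∧ eval v B
eval v (A ∨' B)      = eval v A ∨ eval v B
eval v (A ⇒ B)       = not (eval v A) ∨ eval v B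
eval v (□⟨ 𝔞 ⟩ A)    = v (□⟨ 𝔞 ⟩ A)
eval v (A ▷⟨ 𝔞 ⟩ B)  = v (A ▷⟨ 𝔞 ⟩ B)

Tautology : Formula → Set
Tautology A = (v : Formula → Bool) → eval v A ≡ true

FreshL : ℕ → List Term → Set
FreshL n xs = ivar n ∉ xs

Fresh : ℕ → Formula → Set
Fresh n (pvar p)     = Data.Unit.⊤ where import Data.Unit
Fresh n ⊤'           = Data.Unit.⊤ where import Data.Unit
Fresh n ⊥'           = Data.Unit.⊤ where import Data.Unit
Fresh n (¬' A)       = Fresh n A
Fresh n (A ∧' B)     = Fresh n A × Fresh n B
Fresh n (A ∨' B)     = Fresh n A × Fresh n B
Fresh n (A ⇒ B)      = Fresh n A × Fresh n B
Fresh n (□⟨ 𝔞 ⟩ A)   = FreshL n (seq 𝔞) × Fresh n A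
Fresh n (A ▷⟨ 𝔞 ⟩ B) = FreshL n (seq 𝔞) × Fresh n A × Fresh n B

⋀ : List Formula → Formula
⋀ []       = ⊤'
⋀ (A ∷ Γ)  = A ∧' ⋀ Γ

ΔForm : (𝔞 𝔞k : Label) → Formula → Set
ΔForm 𝔞 𝔞k δ =
  Σ Formula (λ E → Σ Formula (λ F → δ ≡ ((E ▷⟨ 𝔞k ⟩ F) ⇒ (E ▷⟨ 𝔞 ⟩ F))))
  ⊎ Σ Formula (λ E → δ ≡ ((□⟨ 𝔞 ⟩ E) ⇒ (□⟨ 𝔞k ⟩ E)))

infix 2 FIL⊢_
infix 2 _⊢_

data FIL⊢_ : Formula → Set

_⊢_ : List Formula → Formula → Set
Γ ⊢ C = FIL⊢ (⋀ Γ ⇒ C)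

data FIL⊢_ where
  taut : ∀ {A} → Tautology A → FIL⊢ A
  mp   : ∀ {A B} → FIL⊢ (A ⇒ B) → FIL⊢ A → FIL⊢ B
  K    : ∀ 𝔞 A B → FIL⊢ (□⟨ 𝔞 ⟩ (A ⇒ B) ⇒ (□⟨ 𝔞 ⟩ A ⇒ □⟨ 𝔞 ⟩ B))
  box4 : ∀ 𝔞 𝔟 A → FIL⊢ (□⟨ 𝔟 ⟩ A ⇒ □⟨ 𝔞 ⟩ (□⟨ 𝔟 ⟩ A))
  L    : ∀ 𝔞 A → FIL⊢ (□⟨ 𝔞 ⟩ (□⟨ 𝔞 ⟩ A ⇒ A) ⇒ □⟨ 𝔞 ⟩ A)
  J1   : ∀ 𝔞 A B → FIL⊢ (□⟨ 𝔞 ⟩ (A ⇒ B) ⇒ A ▷⟨ 𝔞 ⟩ B)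
  J2   : ∀ 𝔞 A B C → FIL⊢ ((A ▷ B) ∧' (B ▷⟨ 𝔞 ⟩ C) ⇒ A ▷⟨ 𝔞 ⟩ C)
  J2b  : ∀ 𝔞 A B C → FIL⊢ ((A ▷⟨ 𝔞 ⟩ B) ∧' □⟨ 𝔞 ⟩ (B ⇒ C) ⇒ A ▷⟨ 𝔞 ⟩ C)
  J3   : ∀ 𝔞 A B C → FIL⊢ ((A ▷⟨ 𝔞 ⟩ C) ∧' (B ▷⟨ 𝔞 ⟩ C) ⇒ (A ∨' B) ▷⟨ 𝔞 ⟩ C)
  J4   : ∀ 𝔞 A B → FIL⊢ (A ▷⟨ 𝔞 ⟩ B ⇒ (◇ A ⇒ ◇⟨ 𝔞 ⟩ B))
  J5   : ∀ 𝔞 𝔟 A B → FIL⊢ (A ▷⟨ 𝔞 ⟩ (◇⟨ 𝔟 ⟩ B) ⇒ A ▷⟨ 𝔟 ⟩ B)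
  monoB : ∀ 𝔞 k (k∉ : k ∉ seq 𝔞) A → FIL⊢ (□⟨ ext 𝔞 k k∉ ⟩ A ⇒ □⟨ 𝔞 ⟩ A)
  monoI : ∀ 𝔞 k (k∉ : k ∉ seq 𝔞) A B → FIL⊢ (A ▷⟨ 𝔞 ⟩ B ⇒ A ▷⟨ ext 𝔞 k k∉ ⟩ B)
  nec  : ∀ 𝔞 {A} → FIL⊢ A → FIL⊢ (□⟨ 𝔞 ⟩ A)
  P    : ∀ 𝔞 𝔟 n (k∉ : ivar n ∉ seq 𝔞) (Γ Δ : List Formula) A B C
         → All (Fresh n) Γ → Fresh n A → Fresh n B → Fresh n C
         → All (ΔForm 𝔞 (ext 𝔞 (ivar n) k∉)) Δ
         → Γ ++ Δ ++ (□⟨ 𝔟 ⟩ (A ▷⟨ ext 𝔞 (ivar n) k∉ ⟩ B) ∷ []) ⊢ C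
         → Γ ++ ((A ▷⟨ 𝔞 ⟩ B) ∷ []) ⊢ C

-- The formulas U_n (for n ≥ 1; U 0 is an unused dummy value)

U : (D : ℕ → Formula) (C : Formula) → ℕ → Formula
U D C zero          = ⊤'
U D C (suc zero)    = ◇ (¬' (D 1 ▷ ¬' C))
U D C (suc (suc m)) = ◇ ((D (suc m) ▷ D (suc (suc m))) ∧' U D C (suc m))

{-# OPTIONS --safe #-}
-- It suffices to prove Φ → ◇ᵏ(B ∧ □C) for the antecedent Φ: necessitation and J1 give
-- Φ ▷ ◇ᵏ(B ∧ □C), and J5 turns this into Φ ▷ᵏ (B ∧ □C).  By J2, (Dₙ ▷ A) ∧ (A ▷ᵏ B)
-- gives Dₙ ▷ᵏ B, so the heart of the matter is that Uₙ ∧ (Dₙ ▷ᶜ B) → ◇ᶜ(B ∧ □C)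
-- holds for every label c, by induction on n.  For the innermost formula
-- ¬(D₁ ▷ ¬C) this is a contraposition: □ᶜ¬(B ∧ □C) makes B → ◇¬C necessary in c,
-- so D₁ ▷ᶜ B yields D₁ ▷ᶜ ◇¬C and hence D₁ ▷ ¬C by J5.  Each outer ◇ is passed
-- through with rule P: it replaces D ▷ᶜ B by □ᶜ′(D ▷ᶜ′ B) for a fresh extension
-- c′ = c,j, under which the claim for c′ gives X ▷ᶜ′ (B ∧ □C); the side formula of P
-- brings this down to X ▷ᶜ (B ∧ □C), and J4 turns ◇X into ◇ᶜ(B ∧ □C).

module Submission where

open import Data.Bool using (Bool; true; false; not; _∧_; _∨_; T)
open import Data.Bool.Properties using (T-≡; T-∧)
open import Data.Fin using (Fin; zero; suc)
open import Data.List using (List; []; _∷_)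
open import Data.List.Relation.Unary.All using ([]; _∷_)
open import Data.List.Relation.Unary.Any using (here; there)
open import Data.Nat using (ℕ; zero; suc; _≤_; _<_; _⊔_)
open import Data.Nat.Properties using (m⊔n<o⇒m<o; m⊔n<o⇒n<o; ≤-refl; <-irrefl)
open import Data.Product using (∃; _,_; proj₁; proj₂)
open import Data.Sum using (inj₁)
open import Data.Vec using (Vec; []; _∷_; lookup; map)
open import Data.Vec.Properties using (lookup-map)
open import Function using (_∘_)
open import Function.Bundles using (Equivalence)
open import Relation.Binary.PropositionalEquality using (_≡_; refl; sym; trans; cong; cong₂)

open import Defs

infixr 4 _⇒ᵖ_
infixr 6 _∧ᵖ_
infix 9 ¬ᵖ_

data Prop (n : ℕ) : Set where
  var  : Fin n → Prop n
  ⊤ᵖ   : Prop n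
  ¬ᵖ_  : Prop n → Prop n
  _∧ᵖ_ : Prop n → Prop n → Prop n
  _⇒ᵖ_ : Prop n → Prop n → Prop n

⟦_⟧ : ∀ {n} → Prop n → Vec Formula n → Formula
⟦ var i ⟧   ρ = lookup ρ i
⟦ ⊤ᵖ ⟧      ρ = ⊤'
⟦ ¬ᵖ φ ⟧    ρ = ¬' ⟦ φ ⟧ ρ
⟦ φ ∧ᵖ ψ ⟧ ρ = ⟦ φ ⟧ ρ ∧' ⟦ ψ ⟧ ρ
⟦ φ ⇒ᵖ ψ ⟧ ρ = ⟦ φ ⟧ ρ ⇒ ⟦ ψ ⟧ ρ

truth : ∀ {n} → Prop n → Vec Bool n → Bool
truth (var i)   β = lookup β i
truth ⊤ᵖ        β = true
truth (¬ᵖ φ)    β = not (truth φ β)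
truth (φ ∧ᵖ ψ) β = truth φ β ∧ truth ψ β
truth (φ ⇒ᵖ ψ) β = not (truth φ β) ∨ truth ψ β

eval-⟦⟧ : ∀ v {n} (φ : Prop n) ρ → eval v (⟦ φ ⟧ ρ) ≡ truth φ (map (eval v) ρ)
eval-⟦⟧ v (var i)   ρ = sym (lookup-map i (eval v) ρ)
eval-⟦⟧ v ⊤ᵖ        ρ = refl
eval-⟦⟧ v (¬ᵖ φ)    ρ = cong not (eval-⟦⟧ v φ ρ)
eval-⟦⟧ v (φ ∧ᵖ ψ) ρ = cong₂ _∧_ (eval-⟦⟧ v φ ρ) (eval-⟦⟧ v ψ ρ)
eval-⟦⟧ v (φ ⇒ᵖ ψ) ρ = cong₂ (λ a b → not a ∨ b) (eval-⟦⟧ v φ ρ) (eval-⟦⟧ v ψ ρ)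

valid : ∀ n → (Vec Bool n → Bool) → Bool
valid zero    f = f []
valid (suc n) f = valid n (f ∘ (true ∷_)) ∧ valid n (f ∘ (false ∷_))

valid-sound : ∀ n f → T (valid n f) → ∀ β → f β ≡ true
valid-sound zero    f ok [] = Equivalence.to T-≡ ok
valid-sound (suc n) f ok (true ∷ β)  = valid-sound n _ (proj₁ (Equivalence.to T-∧ ok)) β
valid-sound (suc n) f ok (false ∷ β) = valid-sound n _ (proj₂ (Equivalence.to T-∧ ok)) β

-- The validity side condition reduces to ⊤ for a closed schema, so it is found by η.
tautology : ∀ {n} (φ : Prop n) {_ : T (valid n (truth φ))} (ρ : Vec Formula n) → FIL⊢ ⟦ φ ⟧ ρ
tautology φ {ok} ρ = taut λ v → trans (eval-⟦⟧ v φ ρ) (valid-sound _ _ ok (map (eval v) ρ))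

p : ∀ {n} → Prop (suc n)
p = var zero

q : ∀ {n} → Prop (suc (suc n))
q = var (suc zero)

r : ∀ {n} → Prop (suc (suc (suc n)))
r = var (suc (suc zero))

s : ∀ {n} → Prop (suc (suc (suc (suc n))))
s = var (suc (suc (suc zero)))

t : ∀ {n} → Prop (suc (suc (suc (suc (suc n)))))
t = var (suc (suc (suc (suc zero))))

maxVarᵗ : Term → ℕ
maxVarᵗ (ivar n) = n
maxVarᵗ idt      = 0

maxVarˡ : List Term → ℕ
maxVarˡ []       = 0
maxVarˡ (x ∷ xs) = maxVarᵗ x ⊔ maxVarˡ xs

maxVar : Formula → ℕ
maxVar (pvar _)     = 0
maxVar ⊤'           = 0
maxVar ⊥'           = 0
maxVar (¬' A)       = maxVar A
maxVar (A ∧' B)     = maxVar A ⊔ maxVar B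
maxVar (A ∨' B)     = maxVar A ⊔ maxVar B
maxVar (A ⇒ B)      = maxVar A ⊔ maxVar B
maxVar (□⟨ 𝔞 ⟩ A)   = maxVarˡ (seq 𝔞) ⊔ maxVar A
maxVar (A ▷⟨ 𝔞 ⟩ B) = maxVarˡ (seq 𝔞) ⊔ (maxVar A ⊔ maxVar B)

maxVarˡ<⇒FreshL : ∀ xs {n} → maxVarˡ xs < n → FreshL n xs
maxVarˡ<⇒FreshL (ivar m ∷ xs) lt (here refl) = <-irrefl refl (m⊔n<o⇒m<o m _ lt)
maxVarˡ<⇒FreshL (x ∷ xs)      lt (there n∈) = maxVarˡ<⇒FreshL xs (m⊔n<o⇒n<o (maxVarᵗ x) _ lt) n∈

maxVar<⇒Fresh : ∀ A {n} → maxVar A < n → Fresh n A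
maxVar<⇒Fresh (pvar _)     lt = _
maxVar<⇒Fresh ⊤'           lt = _
maxVar<⇒Fresh ⊥'           lt = _
maxVar<⇒Fresh (¬' A)       lt = maxVar<⇒Fresh A lt
maxVar<⇒Fresh (A ∧' B)     lt = maxVar<⇒Fresh A (m⊔n<o⇒m<o _ _ lt) , maxVar<⇒Fresh B (m⊔n<o⇒n<o _ _ lt)
maxVar<⇒Fresh (A ∨' B)     lt = maxVar<⇒Fresh A (m⊔n<o⇒m<o _ _ lt) , maxVar<⇒Fresh B (m⊔n<o⇒n<o _ _ lt)
maxVar<⇒Fresh (A ⇒ B)      lt = maxVar<⇒Fresh A (m⊔n<o⇒m<o _ _ lt) , maxVar<⇒Fresh B (m⊔n<o⇒n<o _ _ lt)
maxVar<⇒Fresh (□⟨ 𝔞 ⟩ A)   lt = maxVarˡ<⇒FreshL (seq 𝔞) (m⊔n<o⇒m<o _ _ lt) , maxVar<⇒Fresh A (m⊔n<o⇒n<o _ _ lt)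
maxVar<⇒Fresh (A ▷⟨ 𝔞 ⟩ B) lt =
  maxVarˡ<⇒FreshL (seq 𝔞) (m⊔n<o⇒m<o _ _ lt) ,
  maxVar<⇒Fresh A (m⊔n<o⇒m<o _ (maxVar B) lt′) , maxVar<⇒Fresh B (m⊔n<o⇒n<o (maxVar A) _ lt′)
  where lt′ = m⊔n<o⇒n<o (maxVarˡ (seq 𝔞)) _ lt

freshFor : (A : Formula) → ∃ λ n → Fresh n A
freshFor A = suc (maxVar A) , maxVar<⇒Fresh A ≤-refl

⇒-trans : ∀ {A B C} → FIL⊢ (A ⇒ B) → FIL⊢ (B ⇒ C) → FIL⊢ (A ⇒ C)
⇒-trans {A} {B} {C} h₁ h₂ = mp (mp (tautology ((p ⇒ᵖ q) ⇒ᵖ (q ⇒ᵖ r) ⇒ᵖ p ⇒ᵖ r) (A ∷ B ∷ C ∷ [])) h₁) h₂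

□-mono : ∀ 𝔞 {A B} → FIL⊢ (A ⇒ B) → FIL⊢ (□⟨ 𝔞 ⟩ A ⇒ □⟨ 𝔞 ⟩ B)
□-mono 𝔞 {A} {B} h = mp (K 𝔞 A B) (nec 𝔞 h)

□[⇒◇]⇒▷ : ∀ 𝔞 𝔟 A B → FIL⊢ (□⟨ 𝔞 ⟩ (A ⇒ ◇⟨ 𝔟 ⟩ B) ⇒ A ▷⟨ 𝔟 ⟩ B)
□[⇒◇]⇒▷ 𝔞 𝔟 A B = ⇒-trans (J1 𝔞 A (◇⟨ 𝔟 ⟩ B)) (J5 𝔞 𝔟 A B)

Yields : (X E B G : Formula) → Set
Yields X E B G = ∀ 𝔠 → FIL⊢ (X ∧' (E ▷⟨ 𝔠 ⟩ B) ⇒ ◇⟨ 𝔠 ⟩ G)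

Yields-◇ : ∀ {X E B G} → Yields X E B G → Yields (◇ X) E B G
Yields-◇ {X} {E} {B} {G} yields 𝔠 with freshFor (◇ X ∧' E ∧' B ∧' ◇⟨ 𝔠 ⟩ G)
... | j , (fX , fE , fB , fG@(j∉𝔠 , _)) =
  mp (tautology ((p ∧ᵖ q ∧ᵖ ⊤ᵖ ⇒ᵖ r) ⇒ᵖ p ∧ᵖ q ⇒ᵖ r) (◇ X ∷ (E ▷⟨ 𝔠 ⟩ B) ∷ ◇⟨ 𝔠 ⟩ G ∷ []))
     (P 𝔠 𝔠ʲ j j∉𝔠 (◇ X ∷ []) (δ ∷ []) E B (◇⟨ 𝔠 ⟩ G)
        (fX ∷ []) fE fB fG (inj₁ (X , G , refl) ∷ []) premise)
  where
  𝔠ʲ : Label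
  𝔠ʲ = ext 𝔠 (ivar j) j∉𝔠

  δ : Formula
  δ = (X ▷⟨ 𝔠ʲ ⟩ G) ⇒ (X ▷⟨ 𝔠 ⟩ G)

  □ʲ⇒▷ʲ : FIL⊢ (□⟨ 𝔠ʲ ⟩ (E ▷⟨ 𝔠ʲ ⟩ B) ⇒ X ▷⟨ 𝔠ʲ ⟩ G)
  □ʲ⇒▷ʲ = ⇒-trans (□-mono 𝔠ʲ (mp (tautology ((p ∧ᵖ q ⇒ᵖ r) ⇒ᵖ q ⇒ᵖ p ⇒ᵖ r)
                                              (X ∷ (E ▷⟨ 𝔠ʲ ⟩ B) ∷ ◇⟨ 𝔠ʲ ⟩ G ∷ []))
                                   (yields 𝔠ʲ)))
                  (□[⇒◇]⇒▷ 𝔠ʲ 𝔠ʲ X G)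

  premise : ◇ X ∷ δ ∷ □⟨ 𝔠ʲ ⟩ (E ▷⟨ 𝔠ʲ ⟩ B) ∷ [] ⊢ ◇⟨ 𝔠 ⟩ G
  premise = mp (mp (tautology ((s ⇒ᵖ q) ⇒ᵖ (r ⇒ᵖ p ⇒ᵖ t) ⇒ᵖ p ∧ᵖ (q ⇒ᵖ r) ∧ᵖ s ∧ᵖ ⊤ᵖ ⇒ᵖ t)
                              (◇ X ∷ (X ▷⟨ 𝔠ʲ ⟩ G) ∷ (X ▷⟨ 𝔠 ⟩ G) ∷ □⟨ 𝔠ʲ ⟩ (E ▷⟨ 𝔠ʲ ⟩ B)
                                ∷ ◇⟨ 𝔠 ⟩ G ∷ []))
                   □ʲ⇒▷ʲ)
               (J4 𝔠 X G)

Yields-▷ : ∀ {X E E′ B G} → Yields X E B G → Yields ((E ▷ E′) ∧' X) E′ B G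
Yields-▷ {X} {E} {E′} {B} {G} yields 𝔠 =
  mp (mp (tautology ((q ∧ᵖ r ⇒ᵖ t) ⇒ᵖ (p ∧ᵖ s ⇒ᵖ r) ⇒ᵖ (p ∧ᵖ q) ∧ᵖ s ⇒ᵖ t)
                    ((E ▷ E′) ∷ X ∷ (E ▷⟨ 𝔠 ⟩ B) ∷ (E′ ▷⟨ 𝔠 ⟩ B) ∷ ◇⟨ 𝔠 ⟩ G ∷ []))
         (yields 𝔠))
     (J2 𝔠 E E′ B)

Yields-¬▷¬ : ∀ E B C → Yields (¬' (E ▷ ¬' C)) E B (B ∧' □ C)
Yields-¬▷¬ E B C 𝔠 =
  mp (mp (mp (tautology ((p ⇒ᵖ q) ⇒ᵖ (r ∧ᵖ q ⇒ᵖ s) ⇒ᵖ (s ⇒ᵖ t) ⇒ᵖ ¬ᵖ t ∧ᵖ r ⇒ᵖ ¬ᵖ p)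
                        (□⟨ 𝔠 ⟩ ¬' (B ∧' □ C) ∷ □⟨ 𝔠 ⟩ (B ⇒ ◇ ¬' C) ∷ (E ▷⟨ 𝔠 ⟩ B)
                          ∷ (E ▷⟨ 𝔠 ⟩ ◇ ¬' C) ∷ (E ▷ ¬' C) ∷ []))
             (□-mono 𝔠 ¬[B∧□C]⇒[B⇒◇¬C]))
         (J2b 𝔠 E B (◇ ¬' C)))
     (J5 𝔠 ε E (¬' C))
  where
  □¬¬C⇒□C : FIL⊢ (□ ¬' ¬' C ⇒ □ C)
  □¬¬C⇒□C = □-mono ε (tautology (¬ᵖ ¬ᵖ p ⇒ᵖ p) (C ∷ []))

  ¬[B∧□C]⇒[B⇒◇¬C] : FIL⊢ (¬' (B ∧' □ C) ⇒ (B ⇒ ◇ ¬' C))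
  ¬[B∧□C]⇒[B⇒◇¬C] = mp (tautology ((p ⇒ᵖ q) ⇒ᵖ ¬ᵖ (r ∧ᵖ q) ⇒ᵖ r ⇒ᵖ ¬ᵖ p)
                                  (□ ¬' ¬' C ∷ □ C ∷ B ∷ []))
                        □¬¬C⇒□C

U-yields : ∀ D B C m → Yields (U D C (suc m)) (D (suc m)) B (B ∧' □ C)
U-yields D B C zero    = Yields-◇ (Yields-¬▷¬ (D 1) B C)
U-yields D B C (suc m) = Yields-◇ (Yields-▷ (U-yields D B C m))

mainTheorem19 : (n : ℕ) → 1 ≤ n → (k : ℕ) → (A B C : Formula) → (D : ℕ → Formula)
    → FIL⊢ ((U D C n ∧' (D n ▷ A) ∧' (A ▷⟨ single (ivar k) ⟩ B))
             ▷⟨ single (ivar k) ⟩ (B ∧' □ C))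
mainTheorem19 (suc m) _ k A B C D =
  mp (□[⇒◇]⇒▷ ε 𝔨 Φ (B ∧' □ C)) (nec ε Φ⇒◇ᵏ)
  where
  𝔨 : Label
  𝔨 = single (ivar k)

  Φ : Formula
  Φ = U D C (suc m) ∧' (D (suc m) ▷ A) ∧' (A ▷⟨ 𝔨 ⟩ B)

  Φ⇒◇ᵏ : FIL⊢ (Φ ⇒ ◇⟨ 𝔨 ⟩ (B ∧' □ C))
  Φ⇒◇ᵏ = mp (mp (tautology ((p ∧ᵖ q ⇒ᵖ r) ⇒ᵖ (s ∧ᵖ r ⇒ᵖ t) ⇒ᵖ s ∧ᵖ p ∧ᵖ q ⇒ᵖ t)
                           ((D (suc m) ▷ A) ∷ (A ▷⟨ 𝔨 ⟩ B) ∷ (D (suc m) ▷⟨ 𝔨 ⟩ B)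
                             ∷ U D C (suc m) ∷ ◇⟨ 𝔨 ⟩ (B ∧' □ C) ∷ []))
                (J2 𝔨 (D (suc m)) A B))
            (U-yields D B C m 𝔨)
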